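{- For all terms $M, M'$, all values $V, V'$ and every variable $x$: if $M\Rightarrow M'$ and $V\Rightarrow V'$, then $M\{V/x\}\Rightarrow M'\{V'/x\}$.
   Context: Terms and values of the call-by-value $\lambda$-calculus are defined by mutual induction from a countably infinite set of variables: values $V ::= x \mid \lambda x.M$ and terms $M,N,L ::= V \mid MN$, up to $\alpha$-conversion, application associating to the left; $\mathrm{fv}(M)$ is the set of free variables and $M\{V/x\}$ capture-avoiding substitution of a value. In all rules below $m\ge0$ and $V,V'$ range over values. Parallel reduction $\Rightarrow$ is the least relation closed under: ($\beta_v$) if $V\Rightarrow V'$ and $M_i\Rightarrow M_i'$ for $0\le i\le m$ then $(\lambda x.M_0)VM_1\dots M_m\Rightarrow M_0'\{V'/x\}M_1'\dots M_m'$; ($\sigma_1$) if $N\Rightarrow N'$, $L\Rightarrow L'$, $M_i\Rightarrow M_i'$ for $0\le i\le m$, and $x\notin\mathrm{fv}(L)$, then $(\lambda x.M_0)NLM_1\dots M_m\Rightarrow(\lambda x.M_0'L')N'M_1'\dots M_m'$; ($\sigma_3$) if $V\Rightarrow V'$, $N\Rightarrow N'$, $L\Rightarrow L'$, $M_i\Rightarrow M_i'$ for $1\le i\le m$, and $x\notin\mathrm{fv}(V)$, then $V((\lambda x.L)N)M_1\dots M_m\Rightarrow(\lambda x.V'L')N'M_1'\dots M_m'$; ($\lambda$) if $M_i\Rightarrow M_i'$ for $0\le i\le m$ then $(\lambda x.M_0)M_1\dots M_m\Rightarrow(\lambda x.M_0')M_1'\dots M_m'$; (var) if $M_i\Rightarrow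 M_i'$ for $1\le i\le m$ then $xM_1\dots M_m\Rightarrow xM_1'\dots M_m'$. -}

module Defs where

open import Data.Nat using (ℕ; zero; suc; _<ᵇ_; _≡ᵇ_; pred)
open import Data.Bool using (if_then_else_)
open import Data.List using (List; []; _∷_)

-- Call-by-value λ-terms up to α-conversion, represented with de Bruijn
-- indices (variables are natural numbers).
data Term : Set where
  var : ℕ → Term
  ƛ_  : Term → Term
  _·_ : Term → Term → Term

infixl 7 _·_
infix  5 ƛ_

data Value : Term → Set where
  v-var : ∀ {i} → Value (var i)
  v-lam : ∀ {M} → Value (ƛ M)

ext : (ℕ → ℕ) → ℕ → ℕ
ext ρ zero    = zero
ext ρ (suc i) = suc (ρ i)

rename : (ℕ → ℕ) → Term → Term
rename ρ (var i) = var (ρ i)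
rename ρ (ƛ M)   = ƛ rename (ext ρ) M
rename ρ (M · N) = rename ρ M · rename ρ N

↑ : Term → Term
↑ = rename suc

exts : (ℕ → Term) → ℕ → Term
exts σ zero    = var zero
exts σ (suc i) = ↑ (σ i)

subst : (ℕ → Term) → Term → Term
subst σ (var i) = σ i
subst σ (ƛ M)   = ƛ subst (exts σ) M
subst σ (M · N) = subst σ M · subst σ N

-- the substitution {V/x}: variable x is replaced by V, variables below x are
-- unchanged, variables above x are decremented (x is removed from the context)
single : ℕ → Term → ℕ → Term
single x V i =
  if i <ᵇ x then var i else (if i ≡ᵇ x then V else var (pred i))

_[_/_] : Term → Term → ℕ → Term
M [ V / x ] = subst (single x V) M

_·⋆_ : Term → List Term → Term
M ·⋆ []       = M
M ·⋆ (N ∷ Ns) = (M · N) ·⋆ Ns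

infix 4 _⇒_ _⇒⋆_

mutual
  data _⇒_ : Term → Term → Set where
    βv : ∀ {M₀ M₀' V V' Ms Ms'} → Value V →
         V ⇒ V' → M₀ ⇒ M₀' → Ms ⇒⋆ Ms' →
         ((ƛ M₀) · V) ·⋆ Ms ⇒ (M₀' [ V' / 0 ]) ·⋆ Ms'
    -- (σ₁)  (λx.M₀) N L M₁…Mₘ ⇒ (λx.M₀' L') N' M₁'…Mₘ'   (x ∉ fv(L): L' is shifted)
    σ₁ : ∀ {M₀ M₀' N N' L L' Ms Ms'} →
         N ⇒ N' → L ⇒ L' → M₀ ⇒ M₀' → Ms ⇒⋆ Ms' →
         ((ƛ M₀) · N · L) ·⋆ Ms ⇒ ((ƛ (M₀' · ↑ L')) · N') ·⋆ Ms'
    -- (σ₃)  V ((λx.L) N) M₁…Mₘ ⇒ (λx.V' L') N' M₁'…Mₘ'   (x ∉ fv(V): V' is shifted)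
    σ₃ : ∀ {V V' N N' L L' Ms Ms'} → Value V →
         V ⇒ V' → N ⇒ N' → L ⇒ L' → Ms ⇒⋆ Ms' →
         (V · ((ƛ L) · N)) ·⋆ Ms ⇒ ((ƛ (↑ V' · L')) · N') ·⋆ Ms'
    lam : ∀ {M₀ M₀' Ms Ms'} →
          M₀ ⇒ M₀' → Ms ⇒⋆ Ms' →
          (ƛ M₀) ·⋆ Ms ⇒ (ƛ M₀') ·⋆ Ms'
    var : ∀ {i Ms Ms'} →
          Ms ⇒⋆ Ms' →
          var i ·⋆ Ms ⇒ var i ·⋆ Ms'

  data _⇒⋆_ : List Term → List Term → Set where
    []  : [] ⇒⋆ []
    _∷_ : ∀ {M M' Ms Ms'} → M ⇒ M' → Ms ⇒⋆ Ms' → (M ∷ Ms) ⇒⋆ (M' ∷ Ms')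

-- Substitutivity is proved once for every relation R between the images of
-- two substitutions that relates only values, relates each variable to itself
-- and is stable under shifting.  With R "the same variable" this says that
-- renaming preserves ⇒, which makes parallel reduction between values stable
-- under shifting, so R can then be that relation.  The substitutions {V/x}
-- and {V'/x} are related by it as soon as V ⇒ V', since a reduct of a value is
-- a value (which is why the hypothesis Value V' is not needed).
module Submission where

open import Data.Nat using (ℕ; zero; suc; _<ᵇ_; _≡ᵇ_)
open import Data.Bool using (true; false)
open import Data.List using ([]; _∷_; map)
open import Data.Empty using (⊥-elim)
open import Function using (_∘_)
open import Relation.Nullary using (¬_)
open import Relation.Binary.PropositionalEquality
  using (_≡_; refl; sym; trans; cong; cong₂; module ≡-Reasoning)
open import Defs

ext-cong : ∀ {ρ ρ' : ℕ → ℕ} → (∀ i → ρ i ≡ ρ' i) → ∀ i → ext ρ i ≡ ext ρ' i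
ext-cong h zero    = refl
ext-cong h (suc i) = cong suc (h i)

rename-cong : ∀ {ρ ρ' : ℕ → ℕ} → (∀ i → ρ i ≡ ρ' i) → ∀ M → rename ρ M ≡ rename ρ' M
rename-cong h (var i) = cong var (h i)
rename-cong h (ƛ M)   = cong ƛ_ (rename-cong (ext-cong h) M)
rename-cong h (M · N) = cong₂ _·_ (rename-cong h M) (rename-cong h N)

exts-cong : ∀ {σ τ : ℕ → Term} → (∀ i → σ i ≡ τ i) → ∀ i → exts σ i ≡ exts τ i
exts-cong h zero    = refl
exts-cong h (suc i) = cong ↑ (h i)

subst-cong : ∀ {σ τ : ℕ → Term} → (∀ i → σ i ≡ τ i) → ∀ M → subst σ M ≡ subst τ M
subst-cong h (var i) = h i
subst-cong h (ƛ M)   = cong ƛ_ (subst-cong (exts-cong h) M)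
subst-cong h (M · N) = cong₂ _·_ (subst-cong h M) (subst-cong h N)

rename-rename : ∀ ρ ρ' M → rename ρ (rename ρ' M) ≡ rename (ρ ∘ ρ') M
rename-rename ρ ρ' (var i) = refl
rename-rename ρ ρ' (ƛ M)   =
  cong ƛ_ (trans (rename-rename (ext ρ) (ext ρ') M) (rename-cong ext-∘ M))
  where
  ext-∘ : ∀ i → ext ρ (ext ρ' i) ≡ ext (ρ ∘ ρ') i
  ext-∘ zero    = refl
  ext-∘ (suc i) = refl
rename-rename ρ ρ' (M · N) = cong₂ _·_ (rename-rename ρ ρ' M) (rename-rename ρ ρ' N)

subst-rename : ∀ σ ρ M → subst σ (rename ρ M) ≡ subst (σ ∘ ρ) M
subst-rename σ ρ (var i) = refl
subst-rename σ ρ (ƛ M)   =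
  cong ƛ_ (trans (subst-rename (exts σ) (ext ρ) M) (subst-cong exts-∘ M))
  where
  exts-∘ : ∀ i → exts σ (ext ρ i) ≡ exts (σ ∘ ρ) i
  exts-∘ zero    = refl
  exts-∘ (suc i) = refl
subst-rename σ ρ (M · N) = cong₂ _·_ (subst-rename σ ρ M) (subst-rename σ ρ N)

rename-subst : ∀ ρ σ M → rename ρ (subst σ M) ≡ subst (rename ρ ∘ σ) M
rename-subst ρ σ (var i) = refl
rename-subst ρ σ (ƛ M)   =
  cong ƛ_ (trans (rename-subst (ext ρ) (exts σ) M) (subst-cong ext-exts M))
  where
  ext-exts : ∀ i → rename (ext ρ) (exts σ i) ≡ exts (rename ρ ∘ σ) i
  ext-exts zero    = refl
  ext-exts (suc i) = trans (rename-rename (ext ρ) suc (σ i)) (sym (rename-rename suc ρ (σ i)))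
rename-subst ρ σ (M · N) = cong₂ _·_ (rename-subst ρ σ M) (rename-subst ρ σ N)

subst-↑ : ∀ σ M → subst (exts σ) (↑ M) ≡ ↑ (subst σ M)
subst-↑ σ M = trans (subst-rename (exts σ) suc M) (sym (rename-subst suc σ M))

subst-subst : ∀ σ τ M → subst σ (subst τ M) ≡ subst (subst σ ∘ τ) M
subst-subst σ τ (var i) = refl
subst-subst σ τ (ƛ M)   =
  cong ƛ_ (trans (subst-subst (exts σ) (exts τ) M) (subst-cong exts-exts M))
  where
  exts-exts : ∀ i → subst (exts σ) (exts τ i) ≡ exts (subst σ ∘ τ) i
  exts-exts zero    = refl
  exts-exts (suc i) = subst-↑ σ (τ i)
subst-subst σ τ (M · N) = cong₂ _·_ (subst-subst σ τ M) (subst-subst σ τ N)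

subst-var : ∀ M → subst var M ≡ M
subst-var (var i) = refl
subst-var (ƛ M)   = cong ƛ_ (trans (subst-cong exts-var M) (subst-var M))
  where
  exts-var : ∀ i → exts var i ≡ var i
  exts-var zero    = refl
  exts-var (suc i) = refl
subst-var (M · N) = cong₂ _·_ (subst-var M) (subst-var N)

rename-as-subst : ∀ ρ M → rename ρ M ≡ subst (var ∘ ρ) M
rename-as-subst ρ (var i) = refl
rename-as-subst ρ (ƛ M)   =
  cong ƛ_ (trans (rename-as-subst (ext ρ) M) (subst-cong exts-var∘ M))
  where
  exts-var∘ : ∀ i → var (ext ρ i) ≡ exts (var ∘ ρ) i
  exts-var∘ zero    = refl
  exts-var∘ (suc i) = refl
rename-as-subst ρ (M · N) = cong₂ _·_ (rename-as-subst ρ M) (rename-as-subst ρ N)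

↑-[/0] : ∀ M W → (↑ M) [ W / 0 ] ≡ M
↑-[/0] M W = trans (subst-rename (single 0 W) suc M) (subst-var M)

subst-[/0] : ∀ σ M W → subst σ (M [ W / 0 ]) ≡ subst (exts σ) M [ subst σ W / 0 ]
subst-[/0] σ M W = begin
  subst σ (M [ W / 0 ])                        ≡⟨ subst-subst σ (single 0 W) M ⟩
  subst (subst σ ∘ single 0 W) M               ≡⟨ subst-cong single-exts M ⟩
  subst (subst (single 0 W') ∘ exts σ) M       ≡⟨ sym (subst-subst (single 0 W') (exts σ) M) ⟩
  subst (exts σ) M [ W' / 0 ]                  ∎
  where
  open ≡-Reasoning
  W' = subst σ W
  single-exts : ∀ i → subst σ (single 0 W i) ≡ subst (single 0 W') (exts σ i)
  single-exts zero    = refl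
  single-exts (suc i) = sym (↑-[/0] (σ i) W')

subst-·⋆ : ∀ σ M Ms → subst σ (M ·⋆ Ms) ≡ subst σ M ·⋆ map (subst σ) Ms
subst-·⋆ σ M []       = refl
subst-·⋆ σ M (N ∷ Ns) = subst-·⋆ σ (M · N) Ns

infix 4 _⇒ᵥ_

data _⇒ᵥ_ : Term → Term → Set where
  var : ∀ {i} → var i ⇒ᵥ var i
  ƛ_  : ∀ {M M'} → M ⇒ M' → ƛ M ⇒ᵥ ƛ M'

⇒ᵥ-value : ∀ {V V'} → V ⇒ᵥ V' → Value V
⇒ᵥ-value var   = v-var
⇒ᵥ-value (ƛ _) = v-lam

⇒ᵥ-·⋆ : ∀ {V V' Ms Ms'} → V ⇒ᵥ V' → Ms ⇒⋆ Ms' → V ·⋆ Ms ⇒ V' ·⋆ Ms'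
⇒ᵥ-·⋆ var     Ms⇒ = var Ms⇒
⇒ᵥ-·⋆ (ƛ M⇒) Ms⇒ = lam M⇒ Ms⇒

application-not-value : ∀ {M N} Ms → ¬ Value ((M · N) ·⋆ Ms)
application-not-value []       ()
application-not-value (_ ∷ Ms) v = application-not-value Ms v

value-⇒ : ∀ {V V'} → Value V → V ⇒ V' → V ⇒ᵥ V'
value-⇒ v (βv {Ms = Ms} _ _ _ _)      = ⊥-elim (application-not-value Ms v)
value-⇒ v (σ₁ {Ms = Ms} _ _ _ _)      = ⊥-elim (application-not-value Ms v)
value-⇒ v (σ₃ {Ms = Ms} _ _ _ _ _)    = ⊥-elim (application-not-value Ms v)
value-⇒ v (lam M⇒ [])                 = ƛ M⇒
value-⇒ v (lam _ (_∷_ {Ms = Ms} _ _)) = ⊥-elim (application-not-value Ms v)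
value-⇒ v (var [])                    = var
value-⇒ v (var (_∷_ {Ms = Ms} _ _))   = ⊥-elim (application-not-value Ms v)

module Substitutivity
  (R : Term → Term → Set)
  (R⇒ᵥ : ∀ {A B} → R A B → A ⇒ᵥ B)
  (R-var : ∀ {i} → R (var i) (var i))
  (R-↑ : ∀ {A B} → R A B → R (↑ A) (↑ B))
  where

  _≈_ : (ℕ → Term) → (ℕ → Term) → Set
  σ ≈ τ = ∀ i → R (σ i) (τ i)

  exts-≈ : ∀ {σ τ} → σ ≈ τ → exts σ ≈ exts τ
  exts-≈ σ≈τ zero    = R-var
  exts-≈ σ≈τ (suc i) = R-↑ (σ≈τ i)

  subst-value : ∀ {σ τ V} → σ ≈ τ → Value V → Value (subst σ V)
  subst-value σ≈τ (v-var {i}) = ⇒ᵥ-value (R⇒ᵥ (σ≈τ i))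
  subst-value σ≈τ v-lam       = v-lam

  subst-⇒-·⋆ : ∀ σ τ {H H' K} Ms Ms' → subst τ H' ≡ K →
    subst σ H ·⋆ map (subst σ) Ms ⇒ K ·⋆ map (subst τ) Ms' →
    subst σ (H ·⋆ Ms) ⇒ subst τ (H' ·⋆ Ms')
  subst-⇒-·⋆ σ τ {H} {H'} Ms Ms' refl d
    rewrite subst-·⋆ σ H Ms | subst-·⋆ τ H' Ms' = d

  mutual
    subst-⇒ : ∀ {σ τ M M'} → σ ≈ τ → M ⇒ M' → subst σ M ⇒ subst τ M'
    subst-⇒ {σ} {τ} σ≈τ (βv {M₀' = M₀'} {V' = V'} {Ms} {Ms'} v V⇒ M₀⇒ Ms⇒) =
      subst-⇒-·⋆ σ τ Ms Ms' (subst-[/0] τ M₀' V')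
        (βv (subst-value σ≈τ v) (subst-⇒ σ≈τ V⇒) (subst-⇒ (exts-≈ σ≈τ) M₀⇒) (subst-⇒⋆ σ≈τ Ms⇒))
    subst-⇒ {σ} {τ} σ≈τ (σ₁ {M₀' = M₀'} {N' = N'} {L' = L'} {Ms} {Ms'} N⇒ L⇒ M₀⇒ Ms⇒) =
      subst-⇒-·⋆ σ τ Ms Ms' (cong (λ Z → (ƛ (subst (exts τ) M₀' · Z)) · subst τ N') (subst-↑ τ L'))
        (σ₁ (subst-⇒ σ≈τ N⇒) (subst-⇒ σ≈τ L⇒) (subst-⇒ (exts-≈ σ≈τ) M₀⇒) (subst-⇒⋆ σ≈τ Ms⇒))
    subst-⇒ {σ} {τ} σ≈τ (σ₃ {V' = V'} {N' = N'} {L' = L'} {Ms} {Ms'} v V⇒ N⇒ L⇒ Ms⇒) =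
      subst-⇒-·⋆ σ τ Ms Ms' (cong (λ Z → (ƛ (Z · subst (exts τ) L')) · subst τ N') (subst-↑ τ V'))
        (σ₃ (subst-value σ≈τ v) (subst-⇒ σ≈τ V⇒) (subst-⇒ σ≈τ N⇒) (subst-⇒ (exts-≈ σ≈τ) L⇒)
            (subst-⇒⋆ σ≈τ Ms⇒))
    subst-⇒ {σ} {τ} σ≈τ (lam {Ms = Ms} {Ms'} M₀⇒ Ms⇒) =
      subst-⇒-·⋆ σ τ Ms Ms' refl (lam (subst-⇒ (exts-≈ σ≈τ) M₀⇒) (subst-⇒⋆ σ≈τ Ms⇒))
    subst-⇒ {σ} {τ} σ≈τ (var {i} {Ms} {Ms'} Ms⇒) =
      subst-⇒-·⋆ σ τ Ms Ms' refl (⇒ᵥ-·⋆ (R⇒ᵥ (σ≈τ i)) (subst-⇒⋆ σ≈τ Ms⇒))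

    subst-⇒⋆ : ∀ {σ τ Ms Ms'} → σ ≈ τ → Ms ⇒⋆ Ms' → map (subst σ) Ms ⇒⋆ map (subst τ) Ms'
    subst-⇒⋆ σ≈τ []         = []
    subst-⇒⋆ σ≈τ (M⇒ ∷ Ms⇒) = subst-⇒ σ≈τ M⇒ ∷ subst-⇒⋆ σ≈τ Ms⇒

data SameVar : Term → Term → Set where
  var : ∀ {i} → SameVar (var i) (var i)

rename-⇒ : ∀ ρ {M M'} → M ⇒ M' → rename ρ M ⇒ rename ρ M'
rename-⇒ ρ {M} {M'} M⇒
  rewrite rename-as-subst ρ M | rename-as-subst ρ M' =
  Substitutivity.subst-⇒ SameVar (λ { var → var }) var (λ { var → var }) (λ _ → var) M⇒

↑-⇒ᵥ : ∀ {V V'} → V ⇒ᵥ V' → ↑ V ⇒ᵥ ↑ V'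
↑-⇒ᵥ var    = var
↑-⇒ᵥ (ƛ M⇒) = ƛ rename-⇒ (ext suc) M⇒

open Substitutivity _⇒ᵥ_ (λ V⇒ → V⇒) var ↑-⇒ᵥ using (subst-⇒)

single-⇒ᵥ : ∀ x {V V'} → V ⇒ᵥ V' → ∀ i → single x V i ⇒ᵥ single x V' i
single-⇒ᵥ x V⇒ i with i <ᵇ x
... | true = var
... | false with i ≡ᵇ x
...   | true  = V⇒
...   | false = var

lemma3p10 : ∀ {M M' V V' : Term} (x : ℕ) → Value V → Value V' →
    M ⇒ M' → V ⇒ V' → (M [ V / x ]) ⇒ (M' [ V' / x ])
lemma3p10 x v _ M⇒ V⇒ = subst-⇒ (single-⇒ᵥ x (value-⇒ v V⇒)) M⇒
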